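{- Let $\mathbb{K}$ be a field, $E$ a finite set, and $\mathcal{F}$ the Gaussian elimination greedoid of a vector family $(v_e)_{e\in E}$ over $\mathbb{K}$. Let $N$ and $C$ be disjoint subsets of $E$ such that: (i) $N\cup\{i\}\in\mathcal{F}$ for every $i\in C$; (ii) $N\cup\{i,j\}\in\mathcal{F}$ for all distinct $i,j\in C$; (iii) $(N\cup\{i,j\})\setminus\{p\}\notin\mathcal{F}$ for every $p\in N$ and all distinct $i,j\in C$. Then $|\mathbb{K}|\ge|C|$.
   Context: For a finite set $E$, a field $\mathbb{K}$, $m\ge|E|$ and $v_e\in\mathbb{K}^m$ ($e\in E$), with $\pi_k:\mathbb{K}^m\to\mathbb{K}^k$ the projection onto the first $k$ coordinates, the Gaussian elimination greedoid of $(v_e)_{e\in E}$ is $\{F\subseteq E:\ (\pi_{|F|}(v_e))_{e\in F}\text{ is linearly independent in }\mathbb{K}^{|F|}\}$. -}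

module Defs where

open import Level using (Level; _⊔_; suc)
open import Data.Nat using (ℕ; _<_; _≤_)
open import Data.Fin using (Fin; toℕ)
open import Data.Fin.Subset using (Subset; _∈_; _∉_; ∣_∣)
open import Data.Product using (Σ; ∃)
open import Relation.Nullary using (¬_)
open import Relation.Binary.PropositionalEquality using (_≡_)
open import Algebra.Bundles using (CommutativeRing)
import Algebra.Properties.Monoid.Sum as MonoidSum

record Field (c ℓ : Level) : Set (Level.suc (c ⊔ ℓ)) where
  field
    commutativeRing : CommutativeRing c ℓ
  open CommutativeRing commutativeRing public
  field
    0≉1     : ¬ (0# ≈ 1#)
    inverse : ∀ x → ¬ (x ≈ 0#) → Σ Carrier (λ y → x * y ≈ 1#)

module _ {c ℓ : Level} (K : Field c ℓ) where
  open Field K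
  open MonoidSum +-monoid using (sum)

  -- The family (π_k(v_e))_{e ∈ F} is linearly independent in K^k, where
  -- v : Fin n → (Fin m → K) is the vector family indexed by E = Fin n, and
  -- π_k keeps the coordinates j with toℕ j < k.
  LinIndepProj : {n m : ℕ} → (Fin n → Fin m → Carrier) → ℕ → Subset n → Set (c ⊔ ℓ)
  LinIndepProj {n} {m} v k F =
    (coef : Fin n → Carrier) →
    (∀ e → e ∉ F → coef e ≈ 0#) →
    (∀ (j : Fin m) → toℕ j < k → sum (λ e → coef e * v e j) ≈ 0#) →
    ∀ e → e ∈ F → coef e ≈ 0#

  InGEGreedoid : {n m : ℕ} → (Fin n → Fin m → Carrier) → Subset n → Set (c ⊔ ℓ)
  InGEGreedoid v F = LinIndepProj v ∣ F ∣ F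

  CardAtLeast : ℕ → Set (c ⊔ ℓ)
  CardAtLeast k = Σ (Fin k → Carrier) (λ f → ∀ a b → f a ≈ f b → a ≡ b)

-- Let k = |N| and cut every v_e down to its first k + 2 coordinates.  By (i), for i ∈ C the
-- vectors v_i, v_N are independent in the first k + 1 coordinates; by (ii), for i ≠ j in C the
-- vectors v_i, v_j, v_N are independent.  Fix i₀ ∈ C and put φ(y) = det(y, v_N), taken in the
-- first k + 1 coordinates, and ψ(y) = det(y, v_i₀, v_N).  Then φ(v_i) ≠ 0 for i ∈ C, and the
-- labels ψ(v_i)/φ(v_i) of the elements i ∈ C are pairwise distinct elements of 𝕂.  Indeed, if
-- the labels of i ≠ j agreed, y = φ(v_j) v_i − φ(v_i) v_j would satisfy φ(y) = 0 and ψ(y) = 0.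
-- The first makes y agree with some z ∈ span(v_N) in the first k + 1 coordinates; the second
-- then puts y − z into span(v_i₀, v_N), where (i) for i₀ forces y − z = 0.  So y ∈ span(v_N),
-- a dependence among v_i, v_j, v_N that contradicts (ii).
module Submission where

open import Defs
open import Level using (Level; _⊔_)
open import Data.Nat as ℕ using (ℕ; zero; suc; _≤_)
import Data.Nat.Properties as ℕ
open import Data.Fin using (Fin; zero; suc; toℕ; punchIn; punchOut; inject₁; inject≤; fromℕ<; _≟_)
open import Data.Fin.Properties
  using (punchInᵢ≢i; punchIn-punchOut; punchIn-injective; suc-injective; toℕ-injective; toℕ-inject₁;
         toℕ-inject≤; toℕ-fromℕ<)
open import Data.Fin.Subset using (Subset; _∈_; _∉_; _∪_; ⁅_⁆; _-_; ∣_∣)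
open import Data.Fin.Subset.Properties using (p⊆p∪q; q⊆p∪q; x∈p∪q⁻; x∈⁅x⁆; x∈⁅y⁆⇒x≡y; ∣p∣≤n; ∪-identityʳ)
open import Data.Bool using (true; false)
open import Data.Product using (Σ; _,_; _×_; proj₁; proj₂)
open import Data.Sum using (_⊎_; inj₁; inj₂)
open import Data.Empty using (⊥; ⊥-elim)
open import Algebra.Bundles using (CommutativeMonoid; CommutativeRing)
open import Function using (_∘_; const; case_of_)
open import Relation.Nullary using (¬_; yes; no)
open import Relation.Nullary.Decidable using (decidable-stable)
open import Relation.Binary using (tri<; tri≈; tri>)
open import Relation.Binary.PropositionalEquality as ≡ using (_≡_; _≢_)

inject₁≢suc : ∀ {n} (p : Fin n) → inject₁ p ≢ suc p
inject₁≢suc {suc n} zero    ()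
inject₁≢suc {suc n} (suc p) eq = inject₁≢suc p (suc-injective eq)

punchIn-≢ : ∀ {n} {i j : Fin (suc n)} (i≢j : i ≢ j) k → k ≢ punchOut i≢j → punchIn i k ≢ j
punchIn-≢ {i = i} i≢j k k≢ eq = k≢ (punchIn-injective i k _ (≡.trans eq (≡.sym (punchIn-punchOut i≢j))))

punchIn-adjacent : ∀ {n} (i : Fin (suc (suc n))) (p : Fin (suc n)) → i ≢ inject₁ p → i ≢ suc p →
  Σ (Fin n) λ p′ → punchIn i (inject₁ p′) ≡ inject₁ p × punchIn i (suc p′) ≡ suc p
punchIn-adjacent zero zero i≢ _ = ⊥-elim (i≢ ≡.refl)
punchIn-adjacent zero (suc p) _ _ = p , ≡.refl , ≡.refl
punchIn-adjacent (suc zero) zero _ i≢ = ⊥-elim (i≢ ≡.refl)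
punchIn-adjacent {suc n} (suc (suc i)) zero _ _ = zero , ≡.refl , ≡.refl
punchIn-adjacent {suc n} (suc i) (suc p) i≢ i≢′ with punchIn-adjacent i p (i≢ ∘ ≡.cong suc) (i≢′ ∘ ≡.cong suc)
... | p′ , eq , eq′ = suc p′ , ≡.cong suc eq , ≡.cong suc eq′

punchIn-inject₁-suc : ∀ {n} (p k : Fin (suc n)) →
  punchIn (inject₁ p) k ≡ punchIn (suc p) k ⊎ (punchIn (inject₁ p) k ≡ suc p × punchIn (suc p) k ≡ inject₁ p)
punchIn-inject₁-suc zero    zero    = inj₂ (≡.refl , ≡.refl)
punchIn-inject₁-suc zero    (suc k) = inj₁ ≡.refl
punchIn-inject₁-suc (suc p) zero    = inj₁ ≡.refl
punchIn-inject₁-suc {suc n} (suc p) (suc k) with punchIn-inject₁-suc p k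
... | inj₁ eq          = inj₁ (≡.cong suc eq)
... | inj₂ (eq , eq′) = inj₂ (≡.cong suc eq , ≡.cong suc eq′)

module DoubleNegation where
  infixl 1 _>>=_
  _>>=_ : ∀ {a b} {A : Set a} {B : Set b} → ¬ ¬ A → (A → ¬ ¬ B) → ¬ ¬ B
  (¬¬a >>= f) ¬b = ¬¬a λ a → f a ¬b

  ¬¬-∀-Fin : ∀ {p n} {P : Fin n → Set p} → (∀ i → ¬ ¬ P i) → ¬ ¬ (∀ i → P i)
  ¬¬-∀-Fin {n = zero}  ¬¬P ¬∀ = ¬∀ λ ()
  ¬¬-∀-Fin {n = suc n} ¬¬P ¬∀ =
    ¬¬P zero λ P0 → ¬¬-∀-Fin (¬¬P ∘ suc) λ Psuc → ¬∀ λ { zero → P0 ; (suc i) → Psuc i }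

module FiniteSums {a ℓ : Level} (M : CommutativeMonoid a ℓ) where
  open import Data.Vec.Functional using (Vector; removeAt)
  open CommutativeMonoid M renaming (_∙_ to _+_; ε to 0#; ∙-congˡ to +-congˡ; identityʳ to +-identityʳ)
  open import Algebra.Properties.CommutativeMonoid.Sum M using (sum; sum-cong-≋; sum-replicate-zero; sum-remove)
  open import Relation.Binary.Reasoning.Setoid setoid

  sum-zero : ∀ {n} (f : Vector Carrier n) → (∀ i → f i ≈ 0#) → sum f ≈ 0#
  sum-zero {n} f f≈0 = trans (sum-cong-≋ f≈0) (sum-replicate-zero n)

  sum-single : ∀ {n} (f : Vector Carrier n) d → (∀ i → i ≢ d → f i ≈ 0#) → sum f ≈ f d
  sum-single {suc n} f d f≈0 = begin
    sum f                         ≈⟨ sum-remove {i = d} f ⟩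
    f d + sum (removeAt f d)      ≈⟨ +-congˡ (sum-zero _ (λ i → f≈0 (punchIn d i) (punchInᵢ≢i d i))) ⟩
    f d + 0#                      ≈⟨ +-identityʳ (f d) ⟩
    f d                           ∎

  sum-pair : ∀ {n} (f : Vector Carrier n) d e → d ≢ e → (∀ i → i ≢ d → i ≢ e → f i ≈ 0#) → sum f ≈ f d + f e
  sum-pair {suc n} f d e d≢e f≈0 = begin
    sum f                                 ≈⟨ sum-remove {i = d} f ⟩
    f d + sum (removeAt f d)              ≈⟨ +-congˡ (sum-single _ (punchOut d≢e) vanish) ⟩
    f d + f (punchIn d (punchOut d≢e))    ≡⟨ ≡.cong (λ i → f d + f i) (punchIn-punchOut d≢e) ⟩
    f d + f e                             ∎
    where
    vanish : ∀ i → i ≢ punchOut d≢e → removeAt f d i ≈ 0#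
    vanish i i≢ = f≈0 (punchIn d i) (punchInᵢ≢i d i)
      (λ eq → i≢ (punchIn-injective d i _ (≡.trans eq (≡.sym (punchIn-punchOut d≢e)))))

module Determinant {c ℓ : Level} (R : CommutativeRing c ℓ) where
  open import Data.List using (List; []; allFin) renaming (_∷_ to _∷ₗ_)
  open import Data.List.Membership.Propositional using () renaming (_∉_ to _∉ₗ_)
  open import Data.List.Membership.Propositional.Properties using (∈-allFin)
  open import Data.List.Relation.Unary.Any using (here; there)
  open CommutativeRing R hiding (zero)
  open import Algebra.Properties.Ring ring using (-‿distribˡ-*; -‿distribʳ-*; -‿involutive; -1*x≈-x; -0#≈0#; +-inverseʳ-unique)
  open import Algebra.Properties.Semiring.Sum semiring
    using (sum; sum-cong-≋; sum-remove; ∑-distrib-+; *-distribˡ-sum; *-distribʳ-sum)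
  open import Algebra.Solver.Ring.NaturalCoefficients.Default commutativeSemiring using (solve; _:+_; _:*_; _:=_)
  open import Data.Vec.Functional using (Vector; _∷_; tail; map; removeAt; updateAt; insertAt)
  open import Data.Vec.Functional.Properties using (updateAt-updates; updateAt-minimal; insertAt-lookup; insertAt-punchIn)
  open FiniteSums +-commutativeMonoid using (sum-pair)
  open import Relation.Binary.Reasoning.Setoid setoid

  -- Matrices are stored by columns: A i r is the entry in row r of column i.
  Family : ℕ → ℕ → Set c
  Family p n = Vector (Vector Carrier n) p

  Matrix : ℕ → Set c
  Matrix n = Family n n

  linComb : ∀ {p n} → Vector Carrier p → Family p n → Vector Carrier n
  linComb κ w r = sum λ a → κ a * w a r

  linComb-neg : ∀ {p n} κ (w : Family p n) r → linComb (λ a → - κ a) w r ≈ - linComb κ w r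
  linComb-neg κ w r = begin
    sum (λ a → - κ a * w a r)      ≈⟨ sum-cong-≋ (λ a → trans (-1*x≈-x _) (-‿distribˡ-* (κ a) (w a r))) ⟨
    sum (λ a → - 1# * (κ a * w a r)) ≈⟨ *-distribˡ-sum (- 1#) (λ a → κ a * w a r) ⟨
    - 1# * linComb κ w r           ≈⟨ -1*x≈-x _ ⟩
    - linComb κ w r                ∎

  minor : ∀ {p n} → Family (suc p) (suc n) → Fin (suc p) → Family p n
  minor w i = removeAt (map tail w) i

  sign : ∀ {n} → Fin n → Carrier
  sign zero    = 1#
  sign (suc i) = - sign i

  sign-inject₁ : ∀ {n} (i : Fin n) → sign (inject₁ i) ≡ sign i
  sign-inject₁ zero    = ≡.refl
  sign-inject₁ (suc i) = ≡.cong -_ (sign-inject₁ i)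

  sign-square : ∀ {n} (i : Fin n) → sign i * sign i ≈ 1#
  sign-square zero    = *-identityˡ 1#
  sign-square (suc i) = begin
    - sign i * - sign i     ≈⟨ -‿distribˡ-* (sign i) (- sign i) ⟨
    - (sign i * - sign i)   ≈⟨ -‿cong (-‿distribʳ-* (sign i) (sign i)) ⟨
    - - (sign i * sign i)   ≈⟨ -‿involutive _ ⟩
    sign i * sign i         ≈⟨ sign-square i ⟩
    1#                      ∎

  det : ∀ {n} → Matrix n → Carrier
  term : ∀ {n} → Matrix (suc n) → Fin (suc n) → Carrier
  det {zero}  A = 1#
  det {suc n} A = sum (term A)
  term A i = sign i * (A i zero * det (minor A i))

  det-cong : ∀ {n} {A B : Matrix n} → (∀ i r → A i r ≈ B i r) → det A ≈ det B
  det-cong {zero}  A≈B = refl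
  det-cong {suc n} A≈B = sum-cong-≋ λ i →
    *-congˡ {sign i} (*-cong (A≈B i zero) (det-cong λ k r → A≈B (punchIn i k) (suc r)))

  det-linear : ∀ {n} (A B C : Matrix n) j α β →
    (∀ r → B j r ≈ α * A j r + β * C j r) →
    (∀ i → i ≢ j → ∀ r → B i r ≈ A i r) → (∀ i → i ≢ j → ∀ r → B i r ≈ C i r) →
    det B ≈ α * det A + β * det C
  det-linear {suc n} A B C j α β Bj≈ B≈A B≈C = begin
    sum (term B)                                        ≈⟨ sum-cong-≋ termwise ⟩
    sum (λ i → α * term A i + β * term C i)
      ≈⟨ ∑-distrib-+ (λ i → α * term A i) (λ i → β * term C i) ⟩
    sum (λ i → α * term A i) + sum (λ i → β * term C i)
      ≈⟨ +-cong (sym (*-distribˡ-sum α (term A))) (sym (*-distribˡ-sum β (term C))) ⟩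
    α * det A + β * det C                               ∎
    where
    termwise : ∀ i → term B i ≈ α * term A i + β * term C i
    termwise i with i ≟ j
    ... | yes ≡.refl = begin
      sign i * (B i zero * det (minor B i))
        ≈⟨ *-congˡ (*-congʳ (Bj≈ zero)) ⟩
      sign i * ((α * A i zero + β * C i zero) * det (minor B i))
        ≈⟨ solve 6 (λ s α a β c d → s :* ((α :* a :+ β :* c) :* d) := α :* (s :* (a :* d)) :+ β :* (s :* (c :* d)))
             refl (sign i) α (A i zero) β (C i zero) (det (minor B i)) ⟩
      α * (sign i * (A i zero * det (minor B i))) + β * (sign i * (C i zero * det (minor B i)))
        ≈⟨ +-cong (*-congˡ (*-congˡ (*-congˡ (det-cong λ k r → B≈A _ (punchInᵢ≢i i k) _))))
                  (*-congˡ (*-congˡ (*-congˡ (det-cong λ k r → B≈C _ (punchInᵢ≢i i k) _)))) ⟩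
      α * term A i + β * term C i ∎
    ... | no i≢j = begin
      sign i * (B i zero * det (minor B i))
        ≈⟨ *-congˡ (*-congˡ (det-linear (minor A i) (minor B i) (minor C i) (punchOut i≢j) α β minorBj≈
             (λ k k≢ r → B≈A _ (punchIn-≢ i≢j k k≢) _) (λ k k≢ r → B≈C _ (punchIn-≢ i≢j k k≢) _))) ⟩
      sign i * (B i zero * (α * det (minor A i) + β * det (minor C i)))
        ≈⟨ solve 6 (λ s b α x β y → s :* (b :* (α :* x :+ β :* y)) := α :* (s :* (b :* x)) :+ β :* (s :* (b :* y)))
             refl (sign i) (B i zero) α (det (minor A i)) β (det (minor C i)) ⟩
      α * (sign i * (B i zero * det (minor A i))) + β * (sign i * (B i zero * det (minor C i)))
        ≈⟨ +-cong (*-congˡ (*-congˡ (*-congʳ (B≈A i i≢j zero)))) (*-congˡ (*-congˡ (*-congʳ (B≈C i i≢j zero)))) ⟩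
      α * term A i + β * term C i ∎
      where
      minorBj≈ : ∀ r → minor B i (punchOut i≢j) r ≈ α * minor A i (punchOut i≢j) r + β * minor C i (punchOut i≢j) r
      minorBj≈ r = ≡.subst (λ k → B k (suc r) ≈ α * A k (suc r) + β * C k (suc r))
                           (≡.sym (punchIn-punchOut i≢j)) (Bj≈ (suc r))

  det-additive : ∀ {n} (A B C : Matrix n) j → (∀ r → B j r ≈ A j r + C j r) →
    (∀ i → i ≢ j → ∀ r → B i r ≈ A i r) → (∀ i → i ≢ j → ∀ r → B i r ≈ C i r) →
    det B ≈ det A + det C
  det-additive A B C j Bj≈ B≈A B≈C = begin
    det B
      ≈⟨ det-linear A B C j 1# 1# (λ r → trans (Bj≈ r) (sym (+-cong (*-identityˡ _) (*-identityˡ _)))) B≈A B≈C ⟩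
    1# * det A + 1# * det C       ≈⟨ +-cong (*-identityˡ _) (*-identityˡ _) ⟩
    det A + det C                 ∎

  det-zeroColumn : ∀ {n} (A : Matrix n) j → (∀ r → A j r ≈ 0#) → det A ≈ 0#
  det-zeroColumn A j Aj≈0 = begin
    det A
      ≈⟨ det-linear A A A j 0# 0# (λ r → trans (Aj≈0 r) (sym 0*x+0*y≈0)) (λ _ _ _ → refl) (λ _ _ _ → refl) ⟩
    0# * det A + 0# * det A   ≈⟨ 0*x+0*y≈0 ⟩
    0#                        ∎
    where
    0*x+0*y≈0 : ∀ {x y} → 0# * x + 0# * y ≈ 0#
    0*x+0*y≈0 = trans (+-cong (zeroˡ _) (zeroˡ _)) (+-identityʳ 0#)

  ∷-same-tail : ∀ {p n} {x y : Vector Carrier n} (U : Family p n) i → i ≢ zero → ∀ r → (x ∷ U) i r ≈ (y ∷ U) i r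
  ∷-same-tail U zero    i≢0 = ⊥-elim (i≢0 ≡.refl)
  ∷-same-tail U (suc i) _ r = refl

  det-linear₀ : ∀ {n} α β (x y : Vector Carrier (suc n)) (U : Family n (suc n)) →
    det ((λ r → α * x r + β * y r) ∷ U) ≈ α * det (x ∷ U) + β * det (y ∷ U)
  det-linear₀ α β x y U = det-linear (x ∷ U) _ (y ∷ U) zero α β (λ r → refl) (∷-same-tail U) (∷-same-tail U)

  det-linComb : ∀ {p n} κ (W : Family p (suc n)) (U : Family n (suc n)) →
    det (linComb κ W ∷ U) ≈ sum (λ a → κ a * det (W a ∷ U))
  det-linComb {zero}  κ W U = det-zeroColumn (linComb κ W ∷ U) zero (λ r → refl)
  det-linComb {suc p} κ W U = begin
    det (linComb κ W ∷ U)
      ≈⟨ det-linear (W zero ∷ U) _ (linComb (tail κ) (tail W) ∷ U) zero (κ zero) 1#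
           (λ r → +-congˡ (sym (*-identityˡ _))) (∷-same-tail U) (∷-same-tail U) ⟩
    κ zero * det (W zero ∷ U) + 1# * det (linComb (tail κ) (tail W) ∷ U)
      ≈⟨ +-congˡ (trans (*-identityˡ _) (det-linComb (tail κ) (tail W) U)) ⟩
    sum (λ a → κ a * det (W a ∷ U)) ∎

  det-adjacent-equal : ∀ {n} (A : Matrix (suc n)) (p : Fin n) → (∀ r → A (inject₁ p) r ≈ A (suc p) r) → det A ≈ 0#
  det-adjacent-equal {suc n} A p A≈ = begin
    sum (term A)                          ≈⟨ sum-pair (term A) (inject₁ p) (suc p) (inject₁≢suc p) others ⟩
    term A (inject₁ p) + term A (suc p)
      ≈⟨ +-congʳ (*-cong (reflexive (sign-inject₁ p)) (*-cong (A≈ zero) (det-cong equalMinors))) ⟩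
    sign p * t + - sign p * t             ≈⟨ +-congˡ (sym (-‿distribˡ-* (sign p) t)) ⟩
    sign p * t + - (sign p * t)           ≈⟨ -‿inverseʳ (sign p * t) ⟩
    0#                                    ∎
    where
    t : Carrier
    t = A (suc p) zero * det (minor A (suc p))
    equalMinors : ∀ k r → minor A (inject₁ p) k r ≈ minor A (suc p) k r
    equalMinors k r with punchIn-inject₁-suc p k
    ... | inj₁ eq          = reflexive (≡.cong (λ i → A i (suc r)) eq)
    ... | inj₂ (eq , eq′) = ≡.subst₂ (λ i i′ → A i (suc r) ≈ A i′ (suc r)) (≡.sym eq) (≡.sym eq′) (sym (A≈ (suc r)))
    others : ∀ i → i ≢ inject₁ p → i ≢ suc p → term A i ≈ 0#
    others i i≢ i≢′ with punchIn-adjacent i p i≢ i≢′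
    ... | p′ , eq , eq′ = begin
      sign i * (A i zero * det (minor A i))
        ≈⟨ *-congˡ (*-congˡ (det-adjacent-equal (minor A i) p′ minorA≈)) ⟩
      sign i * (A i zero * 0#)                ≈⟨ trans (*-congˡ (zeroʳ _)) (zeroʳ _) ⟩
      0#                                      ∎
      where
      minorA≈ : ∀ r → minor A i (inject₁ p′) r ≈ minor A i (suc p′) r
      minorA≈ r = ≡.subst₂ (λ k k′ → A k (suc r) ≈ A k′ (suc r)) (≡.sym eq) (≡.sym eq′) (A≈ (suc r))

  replaceAdjacent : ∀ {n} → Matrix (suc n) → Fin n → (x y : Vector Carrier (suc n)) → Matrix (suc n)
  replaceAdjacent A p x y i with i ≟ inject₁ p | i ≟ suc p
  ... | yes _ | _     = x
  ... | no _  | yes _ = y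
  ... | no _  | no _  = A i

  replaceAdjacent-cong : ∀ {n} (A : Matrix (suc n)) p {x x′ y y′} i →
    (i ≡ inject₁ p → ∀ r → x r ≈ x′ r) → (i ≡ suc p → ∀ r → y r ≈ y′ r) →
    ∀ r → replaceAdjacent A p x y i r ≈ replaceAdjacent A p x′ y′ i r
  replaceAdjacent-cong A p i x≈ y≈ r with i ≟ inject₁ p | i ≟ suc p
  ... | yes i≡ | _      = x≈ i≡ r
  ... | no _   | yes i≡ = y≈ i≡ r
  ... | no _   | no _   = refl

  module _ {n} (A : Matrix (suc n)) (p : Fin n) {x y : Vector Carrier (suc n)} where
    replaceAdjacent-left : ∀ r → replaceAdjacent A p x y (inject₁ p) r ≈ x r
    replaceAdjacent-left r with inject₁ p ≟ inject₁ p
    ... | yes _ = refl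
    ... | no ≢p = ⊥-elim (≢p ≡.refl)

    replaceAdjacent-right : ∀ r → replaceAdjacent A p x y (suc p) r ≈ y r
    replaceAdjacent-right r with suc p ≟ inject₁ p | suc p ≟ suc p
    ... | yes eq | _     = ⊥-elim (inject₁≢suc p (≡.sym eq))
    ... | no _   | yes _ = refl
    ... | no _   | no ≢p = ⊥-elim (≢p ≡.refl)

    replaceAdjacent-other : ∀ i → i ≢ inject₁ p → i ≢ suc p → ∀ r → replaceAdjacent A p x y i r ≈ A i r
    replaceAdjacent-other i i≢ i≢′ r with i ≟ inject₁ p | i ≟ suc p
    ... | yes i≡ | _      = ⊥-elim (i≢ i≡)
    ... | no _   | yes i≡ = ⊥-elim (i≢′ i≡)
    ... | no _   | no _   = refl

    replaceAdjacent-≈ : ∀ (B : Matrix (suc n)) → (∀ r → x r ≈ B (inject₁ p) r) → (∀ r → y r ≈ B (suc p) r) →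
      (∀ i → i ≢ inject₁ p → i ≢ suc p → ∀ r → A i r ≈ B i r) → ∀ i r → replaceAdjacent A p x y i r ≈ B i r
    replaceAdjacent-≈ B x≈ y≈ A≈ i r with i ≟ inject₁ p | i ≟ suc p
    ... | yes ≡.refl | _          = x≈ r
    ... | no _       | yes ≡.refl = y≈ r
    ... | no i≢      | no i≢′     = A≈ i i≢ i≢′ r

  det-swap-adjacent : ∀ {n} (A B : Matrix (suc n)) (p : Fin n) →
    (∀ r → B (inject₁ p) r ≈ A (suc p) r) → (∀ r → B (suc p) r ≈ A (inject₁ p) r) →
    (∀ i → i ≢ inject₁ p → i ≢ suc p → ∀ r → B i r ≈ A i r) → det B ≈ - det A
  det-swap-adjacent {n} A B p Bˡ≈ Bʳ≈ B≈ = +-inverseʳ-unique (det A) (det B) (begin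
    det A + det B
      ≈⟨ sym (+-cong (trans (+-congʳ (equal a)) (+-identityˡ _)) (trans (+-congˡ (equal b)) (+-identityʳ _))) ⟩
    (det (M a a) + det A) + (det B + det (M b b))
      ≈⟨ sym (+-cong (+-congˡ (det-cong (replaceAdjacent-≈ A p A (λ _ → refl) (λ _ → refl) (λ _ _ _ _ → refl))))
                     (+-congʳ (det-cong (replaceAdjacent-≈ A p B (sym ∘ Bˡ≈) (sym ∘ Bʳ≈)
                                                             (λ i i≢ i≢′ r → sym (B≈ i i≢ i≢′ r)))))) ⟩
    (det (M a a) + det (M a b)) + (det (M b a) + det (M b b))
      ≈⟨ sym (+-cong (additiveʳ a a b) (additiveʳ b a b)) ⟩
    det (M a s) + det (M b s)   ≈⟨ sym (additiveˡ a b s) ⟩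
    det (M s s)                 ≈⟨ equal s ⟩
    0#                          ∎)
    where
    M : Vector Carrier (suc n) → Vector Carrier (suc n) → Matrix (suc n)
    M = replaceAdjacent A p
    a b : Vector Carrier (suc n)
    a = A (inject₁ p)
    b = A (suc p)
    s : Vector Carrier (suc n)
    s r = a r + b r
    equal : ∀ x → det (M x x) ≈ 0#
    equal x = det-adjacent-equal (M x x) p (λ r → trans (replaceAdjacent-left A p r) (sym (replaceAdjacent-right A p r)))
    additiveˡ : ∀ x x′ y → det (M (λ r → x r + x′ r) y) ≈ det (M x y) + det (M x′ y)
    additiveˡ x x′ y = det-additive (M x y) _ (M x′ y) (inject₁ p)
      (λ r → trans (replaceAdjacent-left A p r) (sym (+-cong (replaceAdjacent-left A p r) (replaceAdjacent-left A p r))))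
      (λ i i≢ → replaceAdjacent-cong A p i (λ i≡ → ⊥-elim (i≢ i≡)) (λ _ _ → refl))
      (λ i i≢ → replaceAdjacent-cong A p i (λ i≡ → ⊥-elim (i≢ i≡)) (λ _ _ → refl))
    additiveʳ : ∀ x y y′ → det (M x (λ r → y r + y′ r)) ≈ det (M x y) + det (M x y′)
    additiveʳ x y y′ = det-additive (M x y) _ (M x y′) (suc p)
      (λ r → trans (replaceAdjacent-right A p r) (sym (+-cong (replaceAdjacent-right A p r) (replaceAdjacent-right A p r))))
      (λ i i≢ → replaceAdjacent-cong A p i (λ _ _ → refl) (λ i≡ → ⊥-elim (i≢ i≡)))
      (λ i i≢ → replaceAdjacent-cong A p i (λ _ _ → refl) (λ i≡ → ⊥-elim (i≢ i≡)))

  det-equal-columns-apart : ∀ d {n} (A : Matrix n) i j → toℕ j ≡ suc (toℕ i ℕ.+ d) → (∀ r → A i r ≈ A j r) → det A ≈ 0#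
  det-equal-columns-apart d       A i zero    ()
  det-equal-columns-apart zero    A i (suc j) j≡ A≈ =
    det-adjacent-equal A j (λ r → ≡.subst (λ k → A k r ≈ A (suc j) r) i≡ (A≈ r))
    where
    i≡ : i ≡ inject₁ j
    i≡ = toℕ-injective (≡.sym (≡.trans (toℕ-inject₁ j) (≡.trans (ℕ.suc-injective j≡) (ℕ.+-identityʳ (toℕ i)))))
  det-equal-columns-apart (suc d) {suc n} A i (suc j) j≡ A≈ = begin
    det A
      ≈⟨ det-swap-adjacent B A j (sym ∘ replaceAdjacent-right A j) (sym ∘ replaceAdjacent-left A j)
                                 (λ k k≢ k≢′ r → sym (B≈A k k≢ k≢′ r)) ⟩
    - det B
      ≈⟨ -‿cong (det-equal-columns-apart d B i (inject₁ j) inject₁j≡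
                   (λ r → trans (B≈A i i≢ i≢′ r) (trans (A≈ r) (sym (replaceAdjacent-left A j r))))) ⟩
    - 0#         ≈⟨ -0#≈0# ⟩
    0#           ∎
    where
    B : Matrix (suc n)
    B = replaceAdjacent A j (A (suc j)) (A (inject₁ j))
    B≈A : ∀ k → k ≢ inject₁ j → k ≢ suc j → ∀ r → B k r ≈ A k r
    B≈A = replaceAdjacent-other A j
    inject₁j≡ : toℕ (inject₁ j) ≡ suc (toℕ i ℕ.+ d)
    inject₁j≡ = ≡.trans (toℕ-inject₁ j) (≡.trans (ℕ.suc-injective j≡) (ℕ.+-suc (toℕ i) d))
    i≢ : i ≢ inject₁ j
    i≢ i≡ = ℕ.m≢1+m+n (toℕ i) (≡.trans (≡.cong toℕ i≡) inject₁j≡)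
    i≢′ : i ≢ suc j
    i≢′ i≡ = ℕ.m≢1+m+n (toℕ i) (≡.trans (≡.cong toℕ i≡) j≡)

  det-equal-columns : ∀ {n} (A : Matrix n) i j → i ≢ j → (∀ r → A i r ≈ A j r) → det A ≈ 0#
  det-equal-columns A i j i≢j A≈ with ℕ.<-cmp (toℕ i) (toℕ j)
  ... | tri< i<j _ _ = let d , eq = ℕ.m≤n⇒∃[o]m+o≡n i<j in det-equal-columns-apart d A i j (≡.sym eq) A≈
  ... | tri≈ _ i≡j _ = ⊥-elim (i≢j (toℕ-injective i≡j))
  ... | tri> _ _ j<i = let d , eq = ℕ.m≤n⇒∃[o]m+o≡n j<i in det-equal-columns-apart d A j i (≡.sym eq) (sym ∘ A≈)

  det-addMultiple : ∀ {n} (A B : Matrix n) i j t → i ≢ j →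
    (∀ r → B i r ≈ A i r + t * A j r) → (∀ k → k ≢ i → ∀ r → B k r ≈ A k r) → det B ≈ det A
  det-addMultiple {n} A B i j t i≢j Bi≈ B≈ = begin
    det B
      ≈⟨ det-linear A B C i 1# t (λ r → trans (Bi≈ r) (+-cong (sym (*-identityˡ _)) (*-congˡ (sym (Ci≈ r)))))
                    B≈ C≈ ⟩
    1# * det A + t * det C
      ≈⟨ +-cong (*-identityˡ _)
                (*-congˡ (det-equal-columns C i j i≢j (λ r → trans (Ci≈ r) (sym (C≈A j (i≢j ∘ ≡.sym) r))))) ⟩
    det A + t * 0#            ≈⟨ trans (+-congˡ (zeroʳ t)) (+-identityʳ _) ⟩
    det A                     ∎
    where
    C : Matrix n
    C = updateAt A i (const (A j))
    Ci≈ : ∀ r → C i r ≈ A j r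
    Ci≈ r = reflexive (≡.cong (λ z → z r) (updateAt-updates i A))
    C≈A : ∀ k → k ≢ i → ∀ r → C k r ≈ A k r
    C≈A k k≢ r = reflexive (≡.cong (λ z → z r) (updateAt-minimal k i A k≢))
    C≈ : ∀ k → k ≢ i → ∀ r → B k r ≈ C k r
    C≈ k k≢ r = trans (B≈ k k≢ r) (sym (C≈A k k≢ r))

  x+z*y≈x : ∀ {x y z} → z ≈ 0# → x + z * y ≈ x
  x+z*y≈x {x} {y} z≈0 = trans (+-congˡ (trans (*-congʳ z≈0) (zeroˡ y))) (+-identityʳ x)

  addMultiples : ∀ {p n} → Family p n → Fin p → Vector Carrier p → Family p n
  addMultiples w j μ i r = w i r + μ i * w j r

  det-addMultiples-supported : ∀ {n} (is : List (Fin n)) (A : Matrix n) j μ →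
    μ j ≈ 0# → (∀ i → i ∉ₗ is → μ i ≈ 0#) → det (addMultiples A j μ) ≈ det A
  det-addMultiples-supported []          A j μ μj≈0 μ≈0 = det-cong λ i r → x+z*y≈x (μ≈0 i λ ())
  det-addMultiples-supported {n} (i ∷ₗ is) A j μ μj≈0 μ≈0 = begin
    det (addMultiples A j μ)    ≈⟨ clear-i ⟩
    det (addMultiples A j μ′)
      ≈⟨ det-addMultiples-supported is A j μ′ (μ′≈0 j (λ _ → μj≈0)) (λ k k∉ → μ′≈0 k (μ≈0-off k k∉)) ⟩
    det A                       ∎
    where
    μ′ : Vector Carrier n
    μ′ = updateAt μ i (const 0#)
    μ′≈ : ∀ k → k ≢ i → μ′ k ≈ μ k
    μ′≈ k k≢ = reflexive (updateAt-minimal k i μ k≢)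
    μ′≈0 : ∀ k → (k ≢ i → μ k ≈ 0#) → μ′ k ≈ 0#
    μ′≈0 k μk≈0 with k ≟ i
    ... | yes ≡.refl = reflexive (updateAt-updates i μ)
    ... | no k≢i     = trans (μ′≈ k k≢i) (μk≈0 k≢i)
    μ≈0-off : ∀ k → k ∉ₗ is → k ≢ i → μ k ≈ 0#
    μ≈0-off k k∉ k≢i = μ≈0 k λ { (here k≡i) → k≢i k≡i ; (there k∈) → k∉ k∈ }
    clear-i : det (addMultiples A j μ) ≈ det (addMultiples A j μ′)
    clear-i with i ≟ j
    ... | yes ≡.refl = det-cong λ k r → +-congˡ (*-congʳ (sym (μ′≈μ k)))
      where
      μ′≈μ : ∀ k → μ′ k ≈ μ k
      μ′≈μ k with k ≟ i
      ... | yes ≡.refl = trans (μ′≈0 k (λ _ → μj≈0)) (sym μj≈0)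
      ... | no k≢i     = μ′≈ k k≢i
    ... | no i≢j = det-addMultiple (addMultiples A j μ′) (addMultiples A j μ) i j (μ i) i≢j
      (λ r → sym (+-cong (x+z*y≈x (μ′≈0 i λ i≢i → ⊥-elim (i≢i ≡.refl)))
                         (*-congˡ (x+z*y≈x (μ′≈0 j λ _ → μj≈0)))))
      (λ k k≢i r → +-congˡ (*-congʳ (sym (μ′≈ k k≢i))))

  det-addMultiples : ∀ {n} (A : Matrix n) j μ → μ j ≈ 0# → det (addMultiples A j μ) ≈ det A
  det-addMultiples {n} A j μ μj≈0 =
    det-addMultiples-supported (allFin n) A j μ μj≈0 (λ i i∉ → ⊥-elim (i∉ (∈-allFin i)))

  linComb-addMultiples : ∀ {p n} κ (w : Family (suc p) n) j μ r →
    linComb κ (removeAt (addMultiples w j μ) j) r ≈ linComb (insertAt κ j (sum λ i → κ i * μ (punchIn j i))) w r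
  linComb-addMultiples {p} κ w j μ r = begin
    sum (λ i → κ i * (w (punchIn j i) r + μ (punchIn j i) * w j r))
      ≈⟨ sum-cong-≋ (λ i → trans (distribˡ (κ i) _ _) (+-congˡ (sym (*-assoc (κ i) _ _)))) ⟩
    sum (λ i → κ i * w (punchIn j i) r + κ i * μ (punchIn j i) * w j r)
      ≈⟨ ∑-distrib-+ (λ i → κ i * w (punchIn j i) r) (λ i → κ i * μ (punchIn j i) * w j r) ⟩
    sum (λ i → κ i * w (punchIn j i) r) + sum (λ i → κ i * μ (punchIn j i) * w j r)
      ≈⟨ +-comm _ _ ⟩
    sum (λ i → κ i * μ (punchIn j i) * w j r) + sum (λ i → κ i * w (punchIn j i) r)
      ≈⟨ +-cong (sym (*-distribʳ-sum (w j r) (λ i → κ i * μ (punchIn j i))))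
                (sum-cong-≋ (λ i → *-congʳ (reflexive (≡.sym (insertAt-punchIn κ j β i))))) ⟩
    β * w j r + sum (λ i → κ′ (punchIn j i) * w (punchIn j i) r)
      ≈⟨ +-congʳ (*-congʳ (reflexive (≡.sym (insertAt-lookup κ j β)))) ⟩
    κ′ j * w j r + sum (λ i → κ′ (punchIn j i) * w (punchIn j i) r)
      ≈⟨ sym (sum-remove (λ i → κ′ i * w i r)) ⟩
    linComb κ′ w r ∎
    where
    β : Carrier
    β = sum λ i → κ i * μ (punchIn j i)
    κ′ : Vector Carrier (suc p)
    κ′ = insertAt κ j β

module LinearIndependence {c ℓ : Level} (K : Field c ℓ) where
  open Field K hiding (zero)
  open Determinant commutativeRing public
  open import Algebra.Properties.Ring ring using (-‿distribˡ-*; -‿distribʳ-*; +-inverseˡ-unique)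
  open import Algebra.Properties.Semiring.Sum semiring using (sum; sum-cong-≋; sum-remove; *-distribˡ-sum)
  open import Data.Vec.Functional using (Vector; _∷_; tail; map; removeAt; insertAt)
  open import Data.Vec.Functional.Properties using (insertAt-lookup; insertAt-punchIn)
  open FiniteSums +-commutativeMonoid using (sum-zero)
  open DoubleNegation
  open import Relation.Binary.Reasoning.Setoid setoid

  inv : ∀ x → ¬ x ≈ 0# → Carrier
  inv x x≉0 = proj₁ (inverse x x≉0)

  *-inverseʳ : ∀ x (x≉0 : ¬ x ≈ 0#) → x * inv x x≉0 ≈ 1#
  *-inverseʳ x x≉0 = proj₂ (inverse x x≉0)

  *-inverseˡ : ∀ x (x≉0 : ¬ x ≈ 0#) → inv x x≉0 * x ≈ 1#
  *-inverseˡ x x≉0 = trans (*-comm _ x) (*-inverseʳ x x≉0)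

  1≉0 : ¬ 1# ≈ 0#
  1≉0 = 0≉1 ∘ sym

  *-cancelˡ-≈0 : ∀ {x y} → ¬ x ≈ 0# → x * y ≈ 0# → y ≈ 0#
  *-cancelˡ-≈0 {x} {y} x≉0 xy≈0 = begin
    y                     ≈⟨ *-identityˡ y ⟨
    1# * y                ≈⟨ *-congʳ (*-inverseˡ x x≉0) ⟨
    inv x x≉0 * x * y     ≈⟨ *-assoc _ x y ⟩
    inv x x≉0 * (x * y)   ≈⟨ *-congˡ xy≈0 ⟩
    inv x x≉0 * 0#        ≈⟨ zeroʳ _ ⟩
    0#                    ∎

  *-≉0 : ∀ {x y} → ¬ x ≈ 0# → ¬ y ≈ 0# → ¬ x * y ≈ 0#
  *-≉0 x≉0 y≉0 = y≉0 ∘ *-cancelˡ-≈0 x≉0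

  sign-≉0 : ∀ {n} (i : Fin n) → ¬ sign i ≈ 0#
  sign-≉0 i sign≈0 = 1≉0 (trans (sym (sign-square i)) (trans (*-congʳ sign≈0) (zeroˡ _)))

  -- Independence is taken in double-negated form: elimination searches for a pivot,
  -- which needs a case split on x ≈ 0# that is only available under ¬ ¬.
  Independent : ∀ {p n} → Family p n → Set (c ⊔ ℓ)
  Independent w = ∀ κ → (∀ r → linComb κ w r ≈ 0#) → ∀ a → ¬ ¬ (κ a ≈ 0#)

  _∈Span_ : ∀ {p n} → Vector Carrier n → Family p n → Set (c ⊔ ℓ)
  _∈Span_ {p} y U = Σ (Vector Carrier p) λ κ → ∀ r → y r ≈ linComb κ U r

  independent-cong : ∀ {p n} {w w′ : Family p n} → Independent w → (∀ a r → w a r ≈ w′ a r) → Independent w′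
  independent-cong ind w≈ κ κ≈0 = ind κ λ r → trans (sum-cong-≋ λ a → *-congˡ (w≈ a r)) (κ≈0 r)

  independent-tail : ∀ {p n} (w : Family (suc p) n) → Independent w → Independent (tail w)
  independent-tail w ind κ κ≈0 a = ind (0# ∷ κ) (λ r → trans (+-congʳ (zeroˡ _)) (trans (+-identityˡ _) (κ≈0 r))) (suc a)

  independent-dropRow : ∀ {p n} (w : Family p (suc n)) → (∀ a → w a zero ≈ 0#) → Independent w → Independent (map tail w)
  independent-dropRow w row≈0 ind κ κ≈0 = ind κ λ
    { zero    → sum-zero _ λ a → trans (*-congˡ (row≈0 a)) (zeroʳ _)
    ; (suc r) → κ≈0 r }

  pivot-or-zeroRow : ∀ {p n} (w : Family p (suc n)) → ¬ ¬ ((Σ (Fin p) λ q → ¬ w q zero ≈ 0#) ⊎ (∀ q → w q zero ≈ 0#))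
  pivot-or-zeroRow w ¬result = ¬¬-∀-Fin (λ q w≉0 → ¬result (inj₁ (q , w≉0))) (¬result ∘ inj₂)

  module Elimination {p n} (w : Family (suc p) (suc n)) (q : Fin (suc p)) (pivot≉0 : ¬ w q zero ≈ 0#) where
    multipliers : Vector Carrier (suc p)
    multipliers = insertAt (λ i → - (w (punchIn q i) zero * inv (w q zero) pivot≉0)) q 0#

    cleared : Family (suc p) (suc n)
    cleared = addMultiples w q multipliers

    eliminated : Family p n
    eliminated = minor cleared q

    multipliers-pivot : multipliers q ≈ 0#
    multipliers-pivot = reflexive (insertAt-lookup _ q 0#)

    cleared-pivot : ∀ r → cleared q r ≈ w q r
    cleared-pivot r = x+z*y≈x multipliers-pivot

    cleared-row₀ : ∀ i → cleared (punchIn q i) zero ≈ 0#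
    cleared-row₀ i = begin
      x + multipliers (punchIn q i) * w q zero
        ≡⟨ ≡.cong (λ m → x + m * w q zero) (insertAt-punchIn _ q 0# i) ⟩
      x + - (x * α) * w q zero                    ≈⟨ +-congˡ (-‿distribˡ-* (x * α) (w q zero)) ⟨
      x + - (x * α * w q zero)
        ≈⟨ +-congˡ (-‿cong (trans (*-assoc x α _) (trans (*-congˡ (*-inverseˡ _ pivot≉0)) (*-identityʳ x)))) ⟩
      x + - x                                     ≈⟨ -‿inverseʳ x ⟩
      0#                                          ∎
      where
      x α : Carrier
      x = w (punchIn q i) zero
      α = inv (w q zero) pivot≉0

    independent-eliminated : Independent w → Independent eliminated
    independent-eliminated ind κ κ≈0 i =
      ≡.subst (λ x → ¬ ¬ (x ≈ 0#)) (insertAt-punchIn κ q _ i) (ind κ′ vanishes (punchIn q i))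
      where
      κ′ : Vector Carrier (suc p)
      κ′ = insertAt κ q (sum λ i → κ i * multipliers (punchIn q i))
      vanishes : ∀ r → linComb κ′ w r ≈ 0#
      vanishes r = trans (sym (linComb-addMultiples κ w q multipliers r)) (removed-vanishes r)
        where
        removed-vanishes : ∀ r → linComb κ (removeAt cleared q) r ≈ 0#
        removed-vanishes zero    = sum-zero _ λ i → trans (*-congˡ (cleared-row₀ i)) (zeroʳ _)
        removed-vanishes (suc r) = κ≈0 r

  det-eliminated : ∀ {n} (A : Matrix (suc n)) q (pivot≉0 : ¬ A q zero ≈ 0#) →
    det A ≈ sign q * (A q zero * det (Elimination.eliminated A q pivot≉0))
  det-eliminated A q pivot≉0 = begin
    det A
      ≈⟨ det-addMultiples A q multipliers multipliers-pivot ⟨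
    sum (term cleared)                                     ≈⟨ sum-remove {i = q} (term cleared) ⟩
    term cleared q + sum (removeAt (term cleared) q)
      ≈⟨ +-congˡ (sum-zero _ λ i → trans (*-congˡ (trans (*-congʳ (cleared-row₀ i)) (zeroˡ _))) (zeroʳ _)) ⟩
    term cleared q + 0#                                    ≈⟨ +-identityʳ _ ⟩
    sign q * (cleared q zero * det eliminated)             ≈⟨ *-congˡ (*-congʳ (cleared-pivot zero)) ⟩
    sign q * (A q zero * det eliminated)                   ∎
    where open Elimination A q pivot≉0

  ¬independent-overfull : ∀ n (w : Family (suc n) n) → ¬ Independent w
  ¬independent-overfull zero    w ind = ind (λ _ → 1#) (λ ()) zero 1≉0
  ¬independent-overfull (suc n) w ind = pivot-or-zeroRow w λ
    { (inj₁ (q , pivot≉0)) → let open Elimination w q pivot≉0 in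
        ¬independent-overfull n eliminated (independent-eliminated ind)
    ; (inj₂ row≈0) →
        ¬independent-overfull n (tail (map tail w)) (independent-tail (map tail w) (independent-dropRow w row≈0 ind)) }

  independent⇒det≉0 : ∀ {n} (A : Matrix n) → Independent A → ¬ det A ≈ 0#
  independent⇒det≉0 {zero}  A ind = 1≉0
  independent⇒det≉0 {suc n} A ind det≈0 = pivot-or-zeroRow A λ
    { (inj₁ (q , pivot≉0)) → let open Elimination A q pivot≉0 in
        *-≉0 (sign-≉0 q) (*-≉0 pivot≉0 (independent⇒det≉0 eliminated (independent-eliminated ind)))
             (trans (sym (det-eliminated A q pivot≉0)) det≈0)
    ; (inj₂ row≈0) → ¬independent-overfull n (map tail A) (independent-dropRow A row≈0 ind) }

  independent-∷ : ∀ {p n} (y : Vector Carrier n) (U : Family p n) → Independent U → ¬ (y ∈Span U) → Independent (y ∷ U)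
  independent-∷ y U ind y∉ μ μ≈0 = λ
    { zero    → head≈0
    ; (suc a) → head≈0 >>= λ μ₀≈0 → ind (tail μ) (tail-vanishes μ₀≈0) a }
    where
    head≈0 : ¬ ¬ (μ zero ≈ 0#)
    head≈0 μ₀≉0 = y∉ ((λ a → - μ₀⁻¹ * μ (suc a)) , y≈)
      where
      μ₀⁻¹ : Carrier
      μ₀⁻¹ = inv (μ zero) μ₀≉0
      y≈ : ∀ r → y r ≈ linComb (λ a → - μ₀⁻¹ * μ (suc a)) U r
      y≈ r = begin
        y r                                   ≈⟨ *-identityˡ (y r) ⟨
        1# * y r                              ≈⟨ *-congʳ (*-inverseˡ (μ zero) μ₀≉0) ⟨
        μ₀⁻¹ * μ zero * y r                      ≈⟨ *-assoc μ₀⁻¹ _ _ ⟩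
        μ₀⁻¹ * (μ zero * y r)                    ≈⟨ *-congˡ (+-inverseˡ-unique _ _ (μ≈0 r)) ⟩
        μ₀⁻¹ * - linComb (tail μ) U r            ≈⟨ -‿distribʳ-* μ₀⁻¹ _ ⟨
        - (μ₀⁻¹ * linComb (tail μ) U r)          ≈⟨ -‿distribˡ-* μ₀⁻¹ _ ⟩
        - μ₀⁻¹ * linComb (tail μ) U r            ≈⟨ *-distribˡ-sum (- μ₀⁻¹) (λ a → μ (suc a) * U a r) ⟩
        sum (λ a → - μ₀⁻¹ * (μ (suc a) * U a r)) ≈⟨ sum-cong-≋ (λ a → *-assoc (- μ₀⁻¹) (μ (suc a)) (U a r)) ⟨
        linComb (λ a → - μ₀⁻¹ * μ (suc a)) U r   ∎
    tail-vanishes : μ zero ≈ 0# → ∀ r → linComb (tail μ) U r ≈ 0#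
    tail-vanishes μ₀≈0 r = trans (sym (trans (+-congʳ (trans (*-congʳ μ₀≈0) (zeroˡ _))) (+-identityˡ _))) (μ≈0 r)

  det≈0⇒∈Span : ∀ {n} (y : Vector Carrier (suc n)) (U : Family n (suc n)) → Independent U →
    det (y ∷ U) ≈ 0# → ¬ ¬ (y ∈Span U)
  det≈0⇒∈Span y U ind det≈0 y∉ = independent⇒det≉0 (y ∷ U) (independent-∷ y U ind y∉) det≈0

  restriction≈0⇒≈0 : ∀ {p m n} (W : Family p n) (ι : Fin m → Fin n) z →
    Independent (λ a r → W a (ι r)) → z ∈Span W → (∀ r → z (ι r) ≈ 0#) → ¬ ¬ (∀ r → z r ≈ 0#)
  restriction≈0⇒≈0 W ι z ind (κ , z≈) zι≈0 = do
    κ≈0 ← ¬¬-∀-Fin (ind κ λ r → trans (sym (z≈ (ι r))) (zι≈0 r))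
    λ ¬z≈0 → ¬z≈0 λ r → trans (z≈ r) (sum-zero _ λ a → trans (*-congʳ (κ≈0 a)) (zeroˡ _))

module SubsetEnumeration where
  open import Data.Vec using (_∷_; here; there)

  enumerate : ∀ {n} (S : Subset n) → Fin ∣ S ∣ → Fin n
  enumerate (true  ∷ S) zero    = zero
  enumerate (true  ∷ S) (suc a) = suc (enumerate S a)
  enumerate (false ∷ S) a       = suc (enumerate S a)

  enumerate-∈ : ∀ {n} (S : Subset n) a → enumerate S a ∈ S
  enumerate-∈ (true  ∷ S) zero    = here
  enumerate-∈ (true  ∷ S) (suc a) = there (enumerate-∈ S a)
  enumerate-∈ (false ∷ S) a       = there (enumerate-∈ S a)

  enumerate-injective : ∀ {n} (S : Subset n) a b → enumerate S a ≡ enumerate S b → a ≡ b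
  enumerate-injective (true  ∷ S) zero    zero    _  = ≡.refl
  enumerate-injective (true  ∷ S) (suc a) (suc b) eq = ≡.cong suc (enumerate-injective S a b (suc-injective eq))
  enumerate-injective (false ∷ S) a       b       eq = enumerate-injective S a b (suc-injective eq)

  ∣∪⁅⁆∣ : ∀ {n} (S : Subset n) i → i ∉ S → ∣ S ∪ ⁅ i ⁆ ∣ ≡ suc ∣ S ∣
  ∣∪⁅⁆∣ (true  ∷ S) zero    i∉ = ⊥-elim (i∉ here)
  ∣∪⁅⁆∣ (false ∷ S) zero    _  = ≡.cong (suc ∘ ∣_∣) (∪-identityʳ S)
  ∣∪⁅⁆∣ (true  ∷ S) (suc i) i∉ = ≡.cong suc (∣∪⁅⁆∣ S i (i∉ ∘ there))
  ∣∪⁅⁆∣ (false ∷ S) (suc i) i∉ = ∣∪⁅⁆∣ S i (i∉ ∘ there)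

open SubsetEnumeration

module GaussianEliminationGreedoid {c ℓ : Level} (K : Field c ℓ) where
  open Field K hiding (zero; _-_)
  open LinearIndependence K
  open import Algebra.Properties.Ring ring using (-‿distribˡ-*)
  open import Algebra.Properties.Semiring.Sum semiring using (sum; sum-cong-≋; ∑-comm; *-distribʳ-sum)
  open import Algebra.Solver.Ring.NaturalCoefficients.Default commutativeSemiring using (solve; _:*_; _:=_)
  open import Data.Vec.Functional using (Vector; _∷_)
  open DoubleNegation
  open FiniteSums +-commutativeMonoid using (sum-zero; sum-single)
  open import Relation.Binary.Reasoning.Setoid setoid

  δ : ∀ {n} → Fin n → Fin n → Carrier
  δ e e′ with e ≟ e′
  ... | yes _ = 1#
  ... | no _  = 0#

  δ-≡ : ∀ {n} (e : Fin n) → δ e e ≈ 1#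
  δ-≡ e with e ≟ e
  ... | yes _ = refl
  ... | no e≢e = ⊥-elim (e≢e ≡.refl)

  δ-≢ : ∀ {n} {e e′ : Fin n} → e ≢ e′ → δ e e′ ≈ 0#
  δ-≢ {e = e} {e′} e≢e′ with e ≟ e′
  ... | yes e≡e′ = ⊥-elim (e≢e′ e≡e′)
  ... | no _     = refl

  pushforward : ∀ {p n} → (Fin p → Fin n) → Vector Carrier p → Vector Carrier n
  pushforward σ κ e = sum λ a → κ a * δ (σ a) e

  module _ {p n} (σ : Fin p → Fin n) (κ : Vector Carrier p) where
    pushforward-image : (∀ a b → σ a ≡ σ b → a ≡ b) → ∀ a → pushforward σ κ (σ a) ≈ κ a
    pushforward-image σ-inj a = begin
      sum (λ b → κ b * δ (σ b) (σ a))
        ≈⟨ sum-single _ a (λ b b≢a → trans (*-congˡ (δ-≢ (b≢a ∘ σ-inj b a))) (zeroʳ _)) ⟩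
      κ a * δ (σ a) (σ a)               ≈⟨ trans (*-congˡ (δ-≡ (σ a))) (*-identityʳ _) ⟩
      κ a                               ∎

    pushforward-outside : ∀ (F : Subset n) → (∀ a → σ a ∈ F) → ∀ e → e ∉ F → pushforward σ κ e ≈ 0#
    pushforward-outside F σ∈F e e∉F =
      sum-zero _ λ a → trans (*-congˡ (δ-≢ λ σa≡e → e∉F (≡.subst (_∈ F) σa≡e (σ∈F a)))) (zeroʳ _)

    linComb-pushforward : ∀ {m} (v : Family n m) j → linComb (pushforward σ κ) v j ≈ linComb κ (v ∘ σ) j
    linComb-pushforward v j = begin
      sum (λ e → sum (λ a → κ a * δ (σ a) e) * v e j)
        ≈⟨ sum-cong-≋ (λ e → *-distribʳ-sum (v e j) (λ a → κ a * δ (σ a) e)) ⟩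
      sum (λ e → sum (λ a → κ a * δ (σ a) e * v e j))   ≈⟨ ∑-comm (λ e a → κ a * δ (σ a) e * v e j) ⟩
      sum (λ a → sum (λ e → κ a * δ (σ a) e * v e j))
        ≈⟨ sum-cong-≋ (λ a → trans (sum-single _ (σ a) (λ e e≢ → vanish a e (e≢ ∘ ≡.sym))) (pick a)) ⟩
      linComb κ (v ∘ σ) j                               ∎
      where
      vanish : ∀ a e → σ a ≢ e → κ a * δ (σ a) e * v e j ≈ 0#
      vanish a e σa≢e = trans (*-congʳ (trans (*-congˡ (δ-≢ σa≢e)) (zeroʳ _))) (zeroˡ _)
      pick : ∀ a → κ a * δ (σ a) (σ a) * v (σ a) j ≈ κ a * v (σ a) j
      pick a = *-congʳ (trans (*-congˡ (δ-≡ (σ a))) (*-identityʳ _))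

  greedoid⇒independent : ∀ {n m p q} (v : Family n m) (F : Subset n) → InGEGreedoid K v F →
    (σ : Fin p → Fin n) → (∀ a → σ a ∈ F) → (∀ a b → σ a ≡ σ b → a ≡ b) →
    (ι : Fin q → Fin m) → (∀ r → toℕ (ι r) ≡ toℕ r) → ∣ F ∣ ≡ q →
    (w : Family p q) → (∀ a r → w a r ≡ v (σ a) (ι r)) → Independent w
  greedoid⇒independent {q = q} v F F∈𝓕 σ σ∈F σ-inj ι ι-toℕ ∣F∣≡q w w≡ κ κ≈0 a κa≉0 = κa≉0 (begin
    κ a                       ≈⟨ pushforward-image σ κ σ-inj a ⟨
    pushforward σ κ (σ a)
      ≈⟨ F∈𝓕 (pushforward σ κ) (pushforward-outside σ κ F σ∈F) vanishes (σ a) (σ∈F a) ⟩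
    0#                        ∎)
    where
    vanishes : ∀ j → toℕ j ℕ.< ∣ F ∣ → linComb (pushforward σ κ) v j ≈ 0#
    vanishes j j<∣F∣ = trans (linComb-pushforward σ κ v j) (≡.subst (λ j′ → linComb κ (v ∘ σ) j′ ≈ 0#) ιr≡j
      (trans (sum-cong-≋ λ a → *-congˡ (reflexive (≡.sym (w≡ a r)))) (κ≈0 r)))
      where
      j<q : toℕ j ℕ.< q
      j<q = ≡.subst (toℕ j ℕ.<_) ∣F∣≡q j<∣F∣
      r : Fin q
      r = fromℕ< j<q
      ιr≡j : ι r ≡ j
      ιr≡j = toℕ-injective (≡.trans (ι-toℕ r) (toℕ-fromℕ< j<q))

  ∷-injective : ∀ {p n} {i : Fin n} {σ : Fin p → Fin n} → (∀ a → σ a ≢ i) → (∀ a b → σ a ≡ σ b → a ≡ b) →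
    ∀ a b → (i ∷ σ) a ≡ (i ∷ σ) b → a ≡ b
  ∷-injective σ≢i σ-inj zero    zero    _  = ≡.refl
  ∷-injective σ≢i σ-inj zero    (suc b) eq = ⊥-elim (σ≢i b (≡.sym eq))
  ∷-injective σ≢i σ-inj (suc a) zero    eq = ⊥-elim (σ≢i a eq)
  ∷-injective σ≢i σ-inj (suc a) (suc b) eq = ≡.cong suc (σ-inj a b eq)

  cross-multiply : ∀ {a b c d} (b≉0 : ¬ b ≈ 0#) (d≉0 : ¬ d ≈ 0#) → a * inv b b≉0 ≈ c * inv d d≉0 → a * d ≈ c * b
  cross-multiply {a} {b} {c} {d} b≉0 d≉0 eq = begin
    a * d                       ≈⟨ *-congʳ (trans (*-congˡ (*-inverseˡ b b≉0)) (*-identityʳ a)) ⟨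
    a * (inv b b≉0 * b) * d     ≈⟨ *-congʳ (*-assoc a _ b) ⟨
    a * inv b b≉0 * b * d       ≈⟨ *-congʳ (*-congʳ eq) ⟩
    c * inv d d≉0 * b * d
      ≈⟨ solve 4 (λ c e b d → c :* e :* b :* d := c :* b :* (e :* d)) refl c (inv d d≉0) b d ⟩
    c * b * (inv d d≉0 * d)     ≈⟨ trans (*-congˡ (*-inverseˡ d d≉0)) (*-identityʳ _) ⟩
    c * b                       ∎

  module _ {n m} (n≤m : n ≤ m) (v : Family n m) (N C : Subset n)
    (N∩C≡∅ : ∀ e → e ∈ N → e ∉ C)
    (N+i∈𝓕 : ∀ i → i ∈ C → InGEGreedoid K v (N ∪ ⁅ i ⁆))
    (N+i+j∈𝓕 : ∀ i j → i ∈ C → j ∈ C → i ≢ j → InGEGreedoid K v ((N ∪ ⁅ i ⁆) ∪ ⁅ j ⁆)) where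

    module Labelling {i₀ i₁} (i₀∈C : i₀ ∈ C) (i₁∈C : i₁ ∈ C) (i₀≢i₁ : i₀ ≢ i₁) where
      k : ℕ
      k = ∣ N ∣

      ∈C⇒∉N : ∀ {i} → i ∈ C → i ∉ N
      ∈C⇒∉N i∈C i∈N = N∩C≡∅ _ i∈N i∈C

      ∣N+i∣ : ∀ {i} → i ∈ C → ∣ N ∪ ⁅ i ⁆ ∣ ≡ suc k
      ∣N+i∣ i∈C = ∣∪⁅⁆∣ N _ (∈C⇒∉N i∈C)

      ∣N+i+j∣ : ∀ {i j} → i ∈ C → j ∈ C → i ≢ j → ∣ (N ∪ ⁅ i ⁆) ∪ ⁅ j ⁆ ∣ ≡ suc (suc k)
      ∣N+i+j∣ {i} {j} i∈C j∈C i≢j = ≡.trans (∣∪⁅⁆∣ (N ∪ ⁅ i ⁆) j j∉) (≡.cong suc (∣N+i∣ i∈C))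
        where
        j∉ : j ∉ N ∪ ⁅ i ⁆
        j∉ j∈ with x∈p∪q⁻ N ⁅ i ⁆ j∈
        ... | inj₁ j∈N = ∈C⇒∉N j∈C j∈N
        ... | inj₂ j∈i = i≢j (≡.sym (x∈⁅y⁆⇒x≡y i j∈i))

      k+2≤m : suc (suc k) ≤ m
      k+2≤m = ℕ.≤-trans (≡.subst (_≤ n) (∣N+i+j∣ i₀∈C i₁∈C i₀≢i₁) (∣p∣≤n ((N ∪ ⁅ i₀ ⁆) ∪ ⁅ i₁ ⁆))) n≤m

      x : Fin n → Vector Carrier (suc (suc k))
      x e r = v e (inject≤ r k+2≤m)

      x′ : Fin n → Vector Carrier (suc k)
      x′ e r = x e (inject₁ r)

      u : Family k (suc (suc k))
      u = x ∘ enumerate N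

      u′ : Family k (suc k)
      u′ = x′ ∘ enumerate N

      enumerate-N≢ : ∀ {i} → i ∈ C → ∀ a → enumerate N a ≢ i
      enumerate-N≢ i∈C a eq = ∈C⇒∉N i∈C (≡.subst (_∈ N) eq (enumerate-∈ N a))

      independent₁ : ∀ {i} → i ∈ C → Independent (x′ i ∷ u′)
      independent₁ {i} i∈C = greedoid⇒independent v _ (N+i∈𝓕 i i∈C) (i ∷ enumerate N)
          (λ { zero → q⊆p∪q N ⁅ i ⁆ (x∈⁅x⁆ i) ; (suc a) → p⊆p∪q ⁅ i ⁆ (enumerate-∈ N a) })
          (∷-injective (enumerate-N≢ i∈C) (enumerate-injective N))
          (λ r → inject≤ (inject₁ r) k+2≤m) (λ r → ≡.trans (toℕ-inject≤ _ k+2≤m) (toℕ-inject₁ r)) (∣N+i∣ i∈C)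
          (x′ i ∷ u′) (λ { zero r → ≡.refl ; (suc a) r → ≡.refl })

      independent₂ : ∀ {i j} → i ∈ C → j ∈ C → i ≢ j → Independent (x i ∷ x j ∷ u)
      independent₂ {i} {j} i∈C j∈C i≢j = greedoid⇒independent v _ (N+i+j∈𝓕 i j i∈C j∈C i≢j) (i ∷ j ∷ enumerate N)
          (λ { zero → p⊆p∪q ⁅ j ⁆ (q⊆p∪q N ⁅ i ⁆ (x∈⁅x⁆ i)) ; (suc zero) → q⊆p∪q _ ⁅ j ⁆ (x∈⁅x⁆ j)
             ; (suc (suc a)) → p⊆p∪q ⁅ j ⁆ (p⊆p∪q ⁅ i ⁆ (enumerate-∈ N a)) })
          (∷-injective (λ { zero j≡i → i≢j (≡.sym j≡i) ; (suc a) → enumerate-N≢ i∈C a })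
            (∷-injective (enumerate-N≢ j∈C) (enumerate-injective N)))
          (λ r → inject≤ r k+2≤m) (λ r → toℕ-inject≤ r k+2≤m) (∣N+i+j∣ i∈C j∈C i≢j)
          (x i ∷ x j ∷ u) (λ { zero r → ≡.refl ; (suc zero) r → ≡.refl ; (suc (suc a)) r → ≡.refl })

      φ : Vector Carrier (suc (suc k)) → Carrier
      φ y = det ((λ r → y (inject₁ r)) ∷ u′)

      ψ : Vector Carrier (suc (suc k)) → Carrier
      ψ y = det (y ∷ x i₀ ∷ u)

      φ-≉0 : ∀ {i} → i ∈ C → ¬ φ (x i) ≈ 0#
      φ-≉0 {i} i∈C = independent⇒det≉0 (x′ i ∷ u′) (independent₁ i∈C)

      label : ∀ i → i ∈ C → Carrier
      label i i∈C = ψ (x i) * inv (φ (x i)) (φ-≉0 i∈C)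

      module _ {i j} (i∈C : i ∈ C) (j∈C : j ∈ C) (i≢j : i ≢ j) (cross : ψ (x i) * φ (x j) ≈ ψ (x j) * φ (x i)) where
        y′ : Vector Carrier (suc k)
        y′ r = φ (x j) * x′ i r + - φ (x i) * x′ j r

        φ-y′≈0 : det (y′ ∷ u′) ≈ 0#
        φ-y′≈0 = begin
          det (y′ ∷ u′)
            ≈⟨ det-linear₀ (φ (x j)) (- φ (x i)) (x′ i) (x′ j) u′ ⟩
          φ (x j) * φ (x i) + - φ (x i) * φ (x j)       ≈⟨ +-cong (*-comm _ _) (-‿distribˡ-* _ _) ⟨
          φ (x i) * φ (x j) + - (φ (x i) * φ (x j))     ≈⟨ -‿inverseʳ _ ⟩
          0#                                            ∎

        module _ (c : Vector Carrier k) (y′≈ : ∀ r → y′ r ≈ linComb c u′ r) where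
          κ : Vector Carrier (suc (suc k))
          κ = φ (x j) ∷ - φ (x i) ∷ λ q → - c q

          z : Vector Carrier (suc (suc k))
          z = linComb κ (x i ∷ x j ∷ u)

          z-restriction≈0 : ∀ r → z (inject₁ r) ≈ 0#
          z-restriction≈0 r = begin
            φ (x j) * x′ i r + (- φ (x i) * x′ j r + linComb (λ q → - c q) u′ r) ≈⟨ +-assoc _ _ _ ⟨
            y′ r + linComb (λ q → - c q) u′ r
              ≈⟨ +-cong (y′≈ r) (linComb-neg c u′ r) ⟩
            linComb c u′ r + - linComb c u′ r                                      ≈⟨ -‿inverseʳ _ ⟩
            0#                                                                     ∎

          ψ-z≈0 : ψ z ≈ 0#
          ψ-z≈0 = begin
            ψ z
              ≈⟨ det-linComb κ (x i ∷ x j ∷ u) (x i₀ ∷ u) ⟩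
            φ (x j) * ψ (x i) + (- φ (x i) * ψ (x j) + sum (λ q → - c q * ψ (u q)))
              ≈⟨ +-congˡ (+-congˡ (sum-zero _ λ q → trans (*-congˡ (ψ-u≈0 q)) (zeroʳ _))) ⟩
            φ (x j) * ψ (x i) + (- φ (x i) * ψ (x j) + 0#)
              ≈⟨ +-cong (trans (*-comm _ _) cross) (trans (+-identityʳ _) (sym (-‿distribˡ-* _ _))) ⟩
            ψ (x j) * φ (x i) + - (φ (x i) * ψ (x j))                 ≈⟨ +-congʳ (*-comm _ _) ⟩
            φ (x i) * ψ (x j) + - (φ (x i) * ψ (x j))                 ≈⟨ -‿inverseʳ _ ⟩
            0#                                                        ∎
            where
            ψ-u≈0 : ∀ q → ψ (u q) ≈ 0#
            ψ-u≈0 q = det-equal-columns (u q ∷ x i₀ ∷ u) zero (suc (suc q)) (λ ()) (λ r → refl)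

          z≈0 : ¬ ¬ (∀ r → z r ≈ 0#)
          z≈0 = do
            z∈Span ← det≈0⇒∈Span z (x i₀ ∷ u)
                       (independent-tail (x i₁ ∷ x i₀ ∷ u) (independent₂ i₁∈C i₀∈C (i₀≢i₁ ∘ ≡.sym))) ψ-z≈0
            restriction≈0⇒≈0 (x i₀ ∷ u) inject₁ z
              (independent-cong {w = x′ i₀ ∷ u′} {w′ = λ a r → (x i₀ ∷ u) a (inject₁ r)} (independent₁ i₀∈C)
                                λ { zero r → refl ; (suc a) r → refl })
              z∈Span z-restriction≈0

        cross-impossible : ⊥
        cross-impossible = (do
          c , y′≈ ← det≈0⇒∈Span y′ u′ (independent-tail (x′ i ∷ u′) (independent₁ i∈C)) φ-y′≈0
          z≈0′ ← z≈0 c y′≈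
          independent₂ i∈C j∈C i≢j (κ c y′≈) z≈0′ zero) (φ-≉0 j∈C)

      label-injective : ∀ {i j} (i∈C : i ∈ C) (j∈C : j ∈ C) → label i i∈C ≈ label j j∈C → i ≡ j
      label-injective {i} {j} i∈C j∈C labels≈ = decidable-stable (i ≟ j) λ i≢j →
        cross-impossible i∈C j∈C i≢j (cross-multiply (φ-≉0 i∈C) (φ-≉0 j∈C) labels≈)

    distinct-labels : ∀ {t} (e : Fin t → Fin n) → (∀ a → e a ∈ C) → (∀ a b → e a ≡ e b → a ≡ b) → CardAtLeast K t
    distinct-labels {zero}        e e∈C e-inj = (λ ()) , λ ()
    distinct-labels {suc zero}    e e∈C e-inj = (λ _ → 0#) , λ { zero zero _ → ≡.refl }
    distinct-labels {suc (suc t)} e e∈C e-inj =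
      (λ a → label (e a) (e∈C a)) , λ a b labels≈ → e-inj a b (label-injective (e∈C a) (e∈C b) labels≈)
      where
      open Labelling (e∈C zero) (e∈C (suc zero)) (λ e₀≡e₁ → case e-inj zero (suc zero) e₀≡e₁ of λ ())

lemma11p10 : {c ℓ : Level} (K : Field c ℓ) (n m : ℕ) → n ≤ m →
    (v : Fin n → Fin m → Field.Carrier K) →
    (N C : Subset n) →
    (∀ e → e ∈ N → e ∉ C) →
    (∀ i → i ∈ C → InGEGreedoid K v (N ∪ ⁅ i ⁆)) →
    (∀ i j → i ∈ C → j ∈ C → ¬ (i ≡ j) → InGEGreedoid K v ((N ∪ ⁅ i ⁆) ∪ ⁅ j ⁆)) →
    (∀ p i j → p ∈ N → i ∈ C → j ∈ C → ¬ (i ≡ j) → ¬ InGEGreedoid K v (((N ∪ ⁅ i ⁆) ∪ ⁅ j ⁆) - p)) →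
    CardAtLeast K ∣ C ∣
lemma11p10 K n m n≤m v N C N∩C≡∅ N+i∈𝓕 N+i+j∈𝓕 _ =
  GaussianEliminationGreedoid.distinct-labels K n≤m v N C N∩C≡∅ N+i∈𝓕 N+i+j∈𝓕
    (enumerate C) (enumerate-∈ C) (enumerate-injective C)
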